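{- Let $\Sigma_{\mathrm U}=\Sigma_{\mathrm{UFD}}\cup\Sigma_{\mathrm{UID}}$ be a set of unary FDs and UIDs closed under finite implication. Then every strongly connected component of the ID graph $\Gamma(\Sigma_{\mathrm{UID}})$ is a transitively closed set of UIDs. Moreover, for every non-trivial SCC $P$, letting $P^{ -1}=\{\tau^{ -1}:\tau\in P\}$, all UIDs of $P^{ -1}$ are in $\Sigma_{\mathrm{UID}}$ and $P^{ -1}$ is an SCC of $\Gamma(\Sigma_{\mathrm{UID}})$.
   Context: A UID $R^p\subseteq S^q$ ($R^p\ne S^q$) says every element at $R^p$ occurs at $S^q$; its reverse $\tau^{ -1}$ is $S^q\subseteq R^p$. A unary FD $R^i\to R^j$ says two $R$-facts agreeing on $R^i$ agree on $R^j$. Closed under finite implication: contains every UID and UFD satisfied by all finite instances satisfying $\Sigma_{\mathrm U}$. A set of UIDs is transitively closed if $R^p\subseteq S^q$, $S^q\subseteq T^r$ in it with $R^p\ne T^r$ imply $R^p\subseteq T^r$ in it. For $\tau:R^p\subseteq S^q$ and $\tau':S^r\subseteq T^u$ in $\Sigma_{\mathrm{UID}}$, $\tau\rightarrowtail\tau'$ iff $S^r\neq S^q$ and $S^r\to S^q\in\Sigma_{\mathrm{UFD}}$ (the first position of $\tau'$ must be in the same relation as the second position of $\tau$). The ID graph $\Gamma(\Sigma_{\mathrm{UID}})$ is the directed graph (with self-loops) on $\Sigma_{\mathrm{UID}}$ with edges $\rightarrowtail$; its SCCs are the maximal sets $P$ such that $\tau\rightarrowtail^*\tau'$ for all $\tau,\tau'\in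 P$ ($\rightarrowtail^*$ reflexive-transitive closure). An SCC is trivial if it is a singleton $\{\tau\}$ with $\tau\not\rightarrowtail\tau$, non-trivial otherwise. -}

module Defs where

open import Data.Nat using (ℕ)
open import Data.Fin using (Fin)
open import Data.Vec using (Vec; lookup)
open import Data.Bool using (Bool; T)
open import Data.List using (List)
open import Data.List.Membership.Propositional using (_∈_)
open import Data.Product using (Σ; ∃; ∃-syntax; _×_; _,_; proj₁)
open import Data.Empty using (⊥)
open import Relation.Nullary using (¬_)
open import Relation.Binary.PropositionalEquality using (_≡_; _≢_)
open import Relation.Binary.Construct.Closure.ReflexiveTransitive using (Star)

-- Subsets of the (finite) sets of UIDs / UFDs / nodes are represented as
-- Bool-valued characteristic functions (classically every subset of a
-- finite set is of this form).
module Schema (n : ℕ) (arity : Fin n → ℕ) where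

  Pos : Set
  Pos = Σ (Fin n) (λ R → Fin (arity R))

  rel : Pos → Fin n
  rel = proj₁

  Fact : Set
  Fact = Σ (Fin n) (λ R → Vec ℕ (arity R))

  Instance : Set
  Instance = List Fact

  data HasAt : Fact → Pos → ℕ → Set where
    at : (R : Fin n) (t : Vec ℕ (arity R)) (i : Fin (arity R)) →
         HasAt (R , t) (R , i) (lookup t i)

  record UID : Set where
    constructor _⊆ᵤ_
    field
      lhs : Pos
      rhs : Pos
  open UID public

  IsUID : UID → Set
  IsUID τ = lhs τ ≢ rhs τ

  _⁻¹ : UID → UID
  τ ⁻¹ = rhs τ ⊆ᵤ lhs τ

  record UFD : Set where
    constructor _⟶_
    field
      src : Pos
      tgt : Pos
  open UFD public

  IsUFD : UFD → Set
  IsUFD φ = (rel (src φ) ≡ rel (tgt φ)) × (src φ ≢ tgt φ)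

  SatUID : Instance → UID → Set
  SatUID I τ = ∀ f a → f ∈ I → HasAt f (lhs τ) a →
               ∃[ g ] (g ∈ I × HasAt g (rhs τ) a)

  SatUFD : Instance → UFD → Set
  SatUFD I φ = ∀ f g a b c → f ∈ I → g ∈ I →
               HasAt f (src φ) a → HasAt g (src φ) a →
               HasAt f (tgt φ) b → HasAt g (tgt φ) c → b ≡ c

  record Constraints : Set where
    field
      ΣUID : UID → Bool
      ΣUFD : UFD → Bool
  open Constraints public

  Sat : Instance → Constraints → Set
  Sat I Σᵤ = (∀ τ → T (ΣUID Σᵤ τ) → SatUID I τ) ×
             (∀ φ → T (ΣUFD Σᵤ φ) → SatUFD I φ)

  WellFormed : Constraints → Set
  WellFormed Σᵤ = (∀ τ → T (ΣUID Σᵤ τ) → IsUID τ) ×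
                  (∀ φ → T (ΣUFD Σᵤ φ) → IsUFD φ)

  FinClosed : Constraints → Set
  FinClosed Σᵤ =
    (∀ τ → IsUID τ → (∀ I → Sat I Σᵤ → SatUID I τ) → T (ΣUID Σᵤ τ)) ×
    (∀ φ → IsUFD φ → (∀ I → Sat I Σᵤ → SatUFD I φ) → T (ΣUFD Σᵤ φ))

  Edge : Constraints → UID → UID → Set
  Edge Σᵤ τ τ' = T (ΣUID Σᵤ τ) × T (ΣUID Σᵤ τ') ×
                 (rel (lhs τ') ≡ rel (rhs τ)) ×
                 (lhs τ' ≢ rhs τ) ×
                 T (ΣUFD Σᵤ (lhs τ' ⟶ rhs τ))

  Reach : Constraints → UID → UID → Set
  Reach Σᵤ = Star (Edge Σᵤ)

  Subset : Set
  Subset = UID → Bool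

  _⊆ˢ_ : Subset → Subset → Set
  P ⊆ˢ Q = ∀ τ → T (P τ) → T (Q τ)

  StronglyConnected : Constraints → Subset → Set
  StronglyConnected Σᵤ P = ∀ τ τ' → T (P τ) → T (P τ') → Reach Σᵤ τ τ'

  IsSCC : Constraints → Subset → Set
  IsSCC Σᵤ P = (P ⊆ˢ ΣUID Σᵤ) × (∃[ τ ] T (P τ)) ×
               StronglyConnected Σᵤ P ×
               (∀ Q → P ⊆ˢ Q → Q ⊆ˢ ΣUID Σᵤ → StronglyConnected Σᵤ Q → Q ⊆ˢ P)

  Trivial : Constraints → Subset → Set
  Trivial Σᵤ P = ∃[ τ ] ((∀ σ → T (P σ) → σ ≡ τ) × T (P τ) × ¬ Edge Σᵤ τ τ)

  NonTrivial : Constraints → Subset → Set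
  NonTrivial Σᵤ P = ¬ Trivial Σᵤ P

  TransitivelyClosed : Subset → Set
  TransitivelyClosed P = ∀ τ τ' → T (P τ) → T (P τ') → rhs τ ≡ lhs τ' →
                         lhs τ ≢ rhs τ' → T (P (lhs τ ⊆ᵤ rhs τ'))

  inverseSet : Subset → Subset
  inverseSet P σ = P (σ ⁻¹)

module Submission where

-- The proof is a cardinality argument on finite instances.  For a finite
-- instance I let weight I p be the number of distinct values at position p.
-- If I ⊨ R^p ⊆ S^q then weight(R^p) ≤ weight(S^q), and equality forces
-- I ⊨ S^q ⊆ R^p; if I ⊨ R^i → R^j then weight(R^j) ≤ weight(R^i), and
-- equality forces I ⊨ R^j → R^i (pigeonhole).  Along an edge τ ↣ τ' we get
-- weight(lhs τ) ≤ weight(rhs τ) ≤ weight(lhs τ'), so around a cycle all these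
-- weights are equal in every finite model of Σ_U, and closure under finite
-- implication puts the reverse UID and UFD of every edge on a cycle into Σ_U.
-- Hence edges, and then paths, inside an SCC can be inverted.

open import Defs
open import Data.Nat using (ℕ; zero; suc; _+_; _≤_; _<_; z≤n; s≤s; _≡ᵇ_)
open import Data.Nat.Properties
open import Data.Fin using (Fin; zero; suc) renaming (_≟_ to _≟F_)
open import Data.Vec using (Vec; lookup; sum; _∷_)
open import Data.List using ([]; _∷_)
open import Data.List.Relation.Unary.Any using (here; there; any?)
open import Data.List.Membership.Propositional using (_∈_; find; lose)
open import Data.Bool using (Bool; true; false; T; _∨_; _∧_)
open import Data.Bool.Properties using (T-∨; T-∧)
open import Data.Sum using (_⊎_; inj₁; inj₂)
open import Data.Product using (_×_; _,_; proj₁; proj₂; ∃-syntax)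
open import Data.Product.Properties using (≡-dec)
open import Function using (Equivalence)
open import Relation.Nullary using (¬_; contradiction; yes; no; Dec)
open import Relation.Nullary.Decidable
  using (T?; map′; _×-dec_; decidable-stable; ⌊_⌋; toWitness; fromWitness)
open import Relation.Binary.PropositionalEquality
  using (_≡_; _≢_; refl; sym; trans; subst; cong; cong₂)
open import Relation.Binary.Definitions using (tri<; tri≈; tri>; DecidableEquality)
open import Relation.Binary.Construct.Closure.ReflexiveTransitive using (ε; _◅_; _◅◅_)

open Equivalence using (to; from)

ind : Bool → ℕ
ind true = 1
ind false = 0

ind-mono : ∀ {a b} → (T a → T b) → ind a ≤ ind b
ind-mono {false} _ = z≤n
ind-mono {true} {true} _ = ≤-refl
ind-mono {true} {false} a⇒b = contradiction _ a⇒b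

ind-true : ∀ {b} → T b → ind b ≡ 1
ind-true {true} _ = refl

ind-false : ∀ {b} → ¬ T b → ind b ≡ 0
ind-false {false} _ = refl
ind-false {true} ¬b = contradiction _ ¬b

ind≤1 : ∀ b → ind b ≤ 1
ind≤1 true = ≤-refl
ind≤1 false = z≤n

count : ℕ → (ℕ → Bool) → ℕ
count zero P = 0
count (suc B) P = ind (P B) + count B P

_⊆[<_]_ : (ℕ → Bool) → ℕ → (ℕ → Bool) → Set
P ⊆[< B ] Q = ∀ x → x < B → T (P x) → T (Q x)

⊆[<]-pred : ∀ {P B Q} → P ⊆[< suc B ] Q → P ⊆[< B ] Q
⊆[<]-pred P⊆Q x x<B = P⊆Q x (m≤n⇒m≤1+n x<B)

count-mono : ∀ B {P Q} → P ⊆[< B ] Q → count B P ≤ count B Q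
count-mono zero _ = z≤n
count-mono (suc B) P⊆Q =
  +-mono-≤ (ind-mono (P⊆Q B ≤-refl)) (count-mono B (⊆[<]-pred P⊆Q))

count-mono-strict : ∀ B {P Q} x → P ⊆[< B ] Q → x < B → T (Q x) → ¬ T (P x) →
                    count B P < count B Q
count-mono-strict (suc B) {P} {Q} x P⊆Q x<1+B Qx ¬Px with m≤n⇒m<n∨m≡n (≤-pred x<1+B)
... | inj₁ x<B = +-mono-≤-< (ind-mono (P⊆Q B ≤-refl))
                   (count-mono-strict B x (⊆[<]-pred P⊆Q) x<B Qx ¬Px)
... | inj₂ refl = begin-strict
  ind (P x) + count x P  ≡⟨ cong (_+ count x P) (ind-false ¬Px) ⟩
  count x P              <⟨ s≤s (count-mono x (⊆[<]-pred P⊆Q)) ⟩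
  1 + count x Q          ≡⟨ cong (_+ count x Q) (sym (ind-true Qx)) ⟩
  ind (Q x) + count x Q  ∎
  where open ≤-Reasoning

count-≥⇒⊇ : ∀ B {P Q} → P ⊆[< B ] Q → count B Q ≤ count B P → Q ⊆[< B ] P
count-≥⇒⊇ B {P} P⊆Q Q≤P x x<B Qx = decidable-stable (T? (P x)) λ ¬Px →
  <⇒≱ (count-mono-strict B x P⊆Q x<B Qx ¬Px) Q≤P

count-insert : ∀ B {Q D} y → (∀ c → T (Q c) → T (D c) ⊎ c ≡ y) →
               count B Q ≤ suc (count B D)
count-insert zero y _ = z≤n
count-insert (suc B) {Q} {D} y Q⊆D+y with B ≟ y
... | yes refl = begin
  ind (Q B) + count B Q  ≤⟨ +-mono-≤ (ind≤1 (Q B)) (count-mono B Q⊆D) ⟩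
  1 + count B D          ≤⟨ s≤s (m≤n+m (count B D) (ind (D B))) ⟩
  1 + (ind (D B) + count B D) ∎
  where
  open ≤-Reasoning
  Q⊆D : Q ⊆[< B ] D
  Q⊆D x x<B Qx with Q⊆D+y x Qx
  ... | inj₁ Dx = Dx
  ... | inj₂ refl = contradiction x<B (<-irrefl refl)
... | no B≢y = begin
  ind (Q B) + count B Q        ≤⟨ +-mono-≤ (ind-mono QB⇒DB) (count-insert B y Q⊆D+y) ⟩
  ind (D B) + suc (count B D)  ≡⟨ +-suc (ind (D B)) (count B D) ⟩
  suc (ind (D B) + count B D)  ∎
  where
  open ≤-Reasoning
  QB⇒DB : T (Q B) → T (D B)
  QB⇒DB QB with Q⊆D+y B QB
  ... | inj₁ DB = DB
  ... | inj₂ B≡y = contradiction B≡y B≢y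

module Image (A : ℕ → Bool) (F : ℕ → ℕ) where

  image : ℕ → ℕ → Bool
  image zero c = false
  image (suc k) c = image k c ∨ (A k ∧ (F k ≡ᵇ c))

  image-∋ : ∀ {a k} → a < k → T (A a) → T (image k (F a))
  image-∋ {a} {suc k} a<1+k Aa with m≤n⇒m<n∨m≡n (≤-pred a<1+k)
  ... | inj₁ a<k = from T-∨ (inj₁ (image-∋ a<k Aa))
  ... | inj₂ refl = from T-∨ (inj₂ (from T-∧ (Aa , ≡⇒≡ᵇ (F a) (F a) refl)))

  image-suc : ∀ k c → T (image (suc k) c) → T (image k c) ⊎ (T (A k) × F k ≡ c)
  image-suc k c t with to T-∨ t
  ... | inj₁ old = inj₁ old
  ... | inj₂ new with to T-∧ new
  ...   | Ak , eq = inj₂ (Ak , ≡ᵇ⇒≡ (F k) c eq)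

  count-image-suc : ∀ B k → count B (image (suc k)) ≤ ind (A k) + count B (image k)
  count-image-suc B k with T? (A k)
  ... | yes Ak = subst (λ i → count B (image (suc k)) ≤ i + count B (image k))
                       (sym (ind-true Ak)) (count-insert B (F k) new-or-old)
    where
    new-or-old : ∀ c → T (image (suc k) c) → T (image k c) ⊎ c ≡ F k
    new-or-old c t with image-suc k c t
    ... | inj₁ old = inj₁ old
    ... | inj₂ (_ , eq) = inj₂ (sym eq)
  ... | no ¬Ak = subst (λ i → count B (image (suc k)) ≤ i + count B (image k))
                       (sym (ind-false ¬Ak)) (count-mono B only-old)
    where
    only-old : image (suc k) ⊆[< B ] image k
    only-old c _ t with image-suc k c t
    ... | inj₁ old = old
    ... | inj₂ (Ak , _) = contradiction Ak ¬Ak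

  count-image : ∀ B k → count B (image k) ≤ count k A
  count-image B zero = ≤-reflexive (count-empty B)
    where
    count-empty : ∀ B → count B (image zero) ≡ 0
    count-empty zero = refl
    count-empty (suc B) = count-empty B
  count-image B (suc k) = ≤-trans (count-image-suc B k) (+-monoʳ-≤ (ind (A k)) (count-image B k))

  -- If F a ≡ F a' with a < a' both in A, then adding a' does not enlarge the image.
  count-image-collision : ∀ B {a a' k} → a < a' → a' < k → T (A a) → T (A a') → F a ≡ F a' →
                          suc (count B (image k)) ≤ count k A
  count-image-collision B {a} {a'} {suc k} a<a' a'<1+k Aa Aa' eq
    with m≤n⇒m<n∨m≡n (≤-pred a'<1+k)
  ... | inj₁ a'<k = begin
    suc (count B (image (suc k)))       ≤⟨ s≤s (count-image-suc B k) ⟩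
    suc (ind (A k) + count B (image k)) ≡⟨ sym (+-suc (ind (A k)) _) ⟩
    ind (A k) + suc (count B (image k)) ≤⟨ +-monoʳ-≤ (ind (A k))
                                             (count-image-collision B a<a' a'<k Aa Aa' eq) ⟩
    ind (A k) + count k A               ∎
    where open ≤-Reasoning
  ... | inj₂ refl = begin
    suc (count B (image (suc a')))      ≤⟨ s≤s (count-mono B no-growth) ⟩
    suc (count B (image a'))            ≤⟨ s≤s (count-image B a') ⟩
    suc (count a' A)                    ≡⟨ cong (_+ count a' A) (sym (ind-true Aa')) ⟩
    ind (A a') + count a' A             ∎
    where
    open ≤-Reasoning
    no-growth : image (suc a') ⊆[< B ] image a'
    no-growth c _ t with image-suc a' c t
    ... | inj₁ old = old
    ... | inj₂ (_ , refl) = subst (λ z → T (image a' z)) eq (image-∋ a<a' Aa)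

  count-covered : ∀ B k {C} → C ⊆[< B ] image k → count B C ≤ count k A
  count-covered B k C⊆ = ≤-trans (count-mono B C⊆) (count-image B k)

  count-covered-collision :
    ∀ B k {C} → C ⊆[< B ] image k →
    ∀ {a a'} → a < a' → a' < k → T (A a) → T (A a') → F a ≡ F a' → count B C < count k A
  count-covered-collision B k C⊆ a<a' a'<k Aa Aa' eq =
    ≤-trans (s≤s (count-mono B C⊆)) (count-image-collision B a<a' a'<k Aa Aa' eq)

  count-covered-≥⇒injective :
    ∀ B k {C} → C ⊆[< B ] image k → count k A ≤ count B C →
    ∀ {a a'} → a < k → a' < k → T (A a) → T (A a') → F a ≡ F a' → a ≡ a'
  count-covered-≥⇒injective B k C⊆ A≤C {a} {a'} a<k a'<k Aa Aa' eq with <-cmp a a'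
  ... | tri≈ _ a≡a' _ = a≡a'
  ... | tri< a<a' _ _ =
    contradiction A≤C (<⇒≱ (count-covered-collision B k C⊆ a<a' a'<k Aa Aa' eq))
  ... | tri> _ _ a'<a =
    contradiction A≤C (<⇒≱ (count-covered-collision B k C⊆ a'<a a<k Aa' Aa (sym eq)))

module Weights {n : ℕ} {arity : Fin n → ℕ} where
  open Schema n arity

  hasAt? : ∀ f p a → Dec (HasAt f p a)
  hasAt? (R , t) (S , i) a with R ≟F S
  ... | no R≢S = no λ { (at _ _ _) → R≢S refl }
  ... | yes refl with lookup t i ≟ a
  ...   | yes refl = yes (at R t i)
  ...   | no t[i]≢a = no λ { (at _ _ _) → t[i]≢a refl }

  values : Instance → Pos → ℕ → Bool
  values I p a = ⌊ any? (λ f → hasAt? f p a) I ⌋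

  values-intro : ∀ {I f p a} → f ∈ I → HasAt f p a → T (values I p a)
  values-intro f∈I f[p]≡a = fromWitness (lose f∈I f[p]≡a)

  values-elim : ∀ {I p a} → T (values I p a) → ∃[ g ] (g ∈ I × HasAt g p a)
  values-elim occurs = find (toWitness occurs)

  valueAt : ∀ {f p a} q → HasAt f p a → rel p ≡ rel q → ∃[ b ] HasAt f q b
  valueAt (_ , j) (at R t _) refl = lookup t j , at R t j

  bound : Instance → ℕ
  bound [] = 0
  bound ((_ , t) ∷ I) = suc (sum t) + bound I

  value<bound : ∀ {I f p a} → f ∈ I → HasAt f p a → a < bound I
  value<bound {(_ , t) ∷ I} (here refl) (at _ _ i) = ≤-trans (s≤s (lookup≤sum t i)) (m≤m+n _ _)
    where
    lookup≤sum : ∀ {k} (v : Vec ℕ k) i → lookup v i ≤ sum v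
    lookup≤sum (x ∷ v) zero = m≤m+n x (sum v)
    lookup≤sum (x ∷ v) (suc i) = ≤-trans (lookup≤sum v i) (m≤n+m (sum v) x)
  value<bound {(_ , t) ∷ I} (there f∈I) f[p]≡a = ≤-trans (value<bound f∈I f[p]≡a) (m≤n+m _ _)

  weight : Instance → Pos → ℕ
  weight I p = count (bound I) (values I p)

  values-⊆ : ∀ {I} τ → SatUID I τ → ∀ B → values I (lhs τ) ⊆[< B ] values I (rhs τ)
  values-⊆ τ I⊨τ B a _ occurs with values-elim occurs
  ... | f , f∈I , f[lhs]≡a with I⊨τ f a f∈I f[lhs]≡a
  ...   | g , g∈I , g[rhs]≡a = values-intro g∈I g[rhs]≡a

  weight-uid : ∀ I τ → SatUID I τ → weight I (lhs τ) ≤ weight I (rhs τ)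
  weight-uid I τ I⊨τ = count-mono (bound I) (values-⊆ τ I⊨τ (bound I))

  uid-reverse : ∀ I τ → SatUID I τ → weight I (rhs τ) ≤ weight I (lhs τ) → SatUID I (τ ⁻¹)
  uid-reverse I τ I⊨τ rhs≤lhs f a f∈I f[rhs]≡a =
    values-elim (count-≥⇒⊇ (bound I) (values-⊆ τ I⊨τ (bound I)) rhs≤lhs
                   a (value<bound f∈I f[rhs]≡a) (values-intro f∈I f[rhs]≡a))

  -- A UFD s → t (s, t in the same relation) satisfied by I, viewed as the
  -- function sending a value at s to the value at t of the first fact carrying it.
  module UFDWeights (I : Instance) (s t : Pos) (s~t : rel s ≡ rel t)
                    (I⊨s→t : SatUFD I (s ⟶ t)) where

    -- firstValue J a : the value at t of the first fact of J with a at s (0 if none).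
    firstValue : Instance → ℕ → ℕ
    firstValue [] a = 0
    firstValue (f ∷ J) a with hasAt? f s a
    ... | yes f[s]≡a = proj₁ (valueAt t f[s]≡a s~t)
    ... | no _ = firstValue J a

    firstValue-witness : ∀ {J f a} → f ∈ J → HasAt f s a →
                         ∃[ g ] (g ∈ J × HasAt g s a × HasAt g t (firstValue J a))
    firstValue-witness {g ∷ J} {a = a} f∈J f[s]≡a with hasAt? g s a
    ... | yes g[s]≡a = g , here refl , g[s]≡a , proj₂ (valueAt t g[s]≡a s~t)
    firstValue-witness {g ∷ J} (here refl) f[s]≡a | no g[s]≢a = contradiction f[s]≡a g[s]≢a
    firstValue-witness {g ∷ J} (there f∈J) f[s]≡a | no _ with firstValue-witness f∈J f[s]≡a
    ... | h , h∈J , h[s]≡a , h[t] = h , there h∈J , h[s]≡a , h[t]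

    ufdMap : ℕ → ℕ
    ufdMap = firstValue I

    ufdMap-correct : ∀ {f a b} → f ∈ I → HasAt f s a → HasAt f t b → ufdMap a ≡ b
    ufdMap-correct {f} {a} {b} f∈I f[s]≡a f[t]≡b with firstValue-witness f∈I f[s]≡a
    ... | g , g∈I , g[s]≡a , g[t] = I⊨s→t g f a (ufdMap a) b g∈I f∈I g[s]≡a f[s]≡a g[t] f[t]≡b

    open Image (values I s) ufdMap

    values-t-covered : values I t ⊆[< bound I ] image (bound I)
    values-t-covered c _ occurs with values-elim occurs
    ... | f , f∈I , f[t]≡c with valueAt s f[t]≡c (sym s~t)
    ...   | a , f[s]≡a = subst (λ z → T (image (bound I) z)) (ufdMap-correct f∈I f[s]≡a f[t]≡c)
                           (image-∋ (value<bound f∈I f[s]≡a) (values-intro f∈I f[s]≡a))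

    weight-ufd : weight I t ≤ weight I s
    weight-ufd = count-covered (bound I) (bound I) values-t-covered

    ufd-reverse : weight I s ≤ weight I t → SatUFD I (t ⟶ s)
    ufd-reverse s≤t f g c a a' f∈I g∈I f[t]≡c g[t]≡c f[s]≡a g[s]≡a' =
      count-covered-≥⇒injective (bound I) (bound I) values-t-covered s≤t
        (value<bound f∈I f[s]≡a) (value<bound g∈I g[s]≡a')
        (values-intro f∈I f[s]≡a) (values-intro g∈I g[s]≡a')
        (trans (ufdMap-correct f∈I f[s]≡a f[t]≡c) (sym (ufdMap-correct g∈I g[s]≡a' g[t]≡c)))

module IDGraph {n : ℕ} {arity : Fin n → ℕ} (Σᵤ : Schema.Constraints n arity)
               (wf : Schema.WellFormed n arity Σᵤ) (fc : Schema.FinClosed n arity Σᵤ) where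
  open Schema n arity
  open Weights {n} {arity}

  _≟ᵤ_ : DecidableEquality UID
  (p ⊆ᵤ q) ≟ᵤ (p' ⊆ᵤ q') =
    map′ (λ (p≡p' , q≡q') → cong₂ _⊆ᵤ_ p≡p' q≡q') (λ eq → cong lhs eq , cong rhs eq)
         ((p ≟ₚ p') ×-dec (q ≟ₚ q'))
    where
    _≟ₚ_ : DecidableEquality Pos
    _≟ₚ_ = ≡-dec _≟F_ _≟F_

  _⇝_ : UID → UID → Set
  _⇝_ = Reach Σᵤ

  _↣_ : UID → UID → Set
  _↣_ = Edge Σᵤ

  weight-edge : ∀ I → Sat I Σᵤ → ∀ {τ τ'} → τ ↣ τ' →
                weight I (rhs τ) ≤ weight I (lhs τ')
  weight-edge I (_ , I⊨UFDs) {τ} {τ'} (_ , _ , τ'~τ , _ , ufd) =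
    UFDWeights.weight-ufd I (lhs τ') (rhs τ) τ'~τ (I⊨UFDs _ ufd)

  -- With weight (lhs τ) ≤ weight (rhs τ) from the UID τ, the weight of the left
  -- position does not decrease along paths.
  weight-path : ∀ I → Sat I Σᵤ → ∀ {τ τ'} → τ ⇝ τ' → weight I (lhs τ) ≤ weight I (lhs τ')
  weight-path I I⊨Σ ε = ≤-refl
  weight-path I I⊨Σ {τ} (e ◅ p) =
    ≤-trans (weight-uid I τ (proj₁ I⊨Σ τ (proj₁ e)))
      (≤-trans (weight-edge I I⊨Σ e) (weight-path I I⊨Σ p))

  -- On a cycle all these weights coincide, so the reverse of the UID and of the
  -- UFD of an edge are finitely implied, hence belong to Σ_U.
  inverse-on-cycle : ∀ {τ τ'} → τ ↣ τ' → τ' ⇝ τ → T (ΣUID Σᵤ (τ ⁻¹))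
  inverse-on-cycle {τ} e@(τ∈Σ , _) back =
    proj₁ fc (τ ⁻¹) (λ rhs≡lhs → proj₁ wf τ τ∈Σ (sym rhs≡lhs)) λ I I⊨Σ →
      uid-reverse I τ (proj₁ I⊨Σ τ τ∈Σ)
        (≤-trans (weight-edge I I⊨Σ e) (weight-path I I⊨Σ back))

  reverse-ufd-on-cycle : ∀ {τ τ'} → τ ↣ τ' → τ' ⇝ τ → T (ΣUFD Σᵤ (rhs τ ⟶ lhs τ'))
  reverse-ufd-on-cycle {τ} {τ'} (τ∈Σ , _ , τ'~τ , τ'≢τ , ufd) back =
    proj₂ fc (rhs τ ⟶ lhs τ') (sym τ'~τ , λ eq → τ'≢τ (sym eq)) λ I I⊨Σ →
      UFDWeights.ufd-reverse I (lhs τ') (rhs τ) τ'~τ (proj₂ I⊨Σ _ ufd)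
        (≤-trans (weight-path I I⊨Σ back) (weight-uid I τ (proj₁ I⊨Σ τ τ∈Σ)))

  OnCycle : UID → Set
  OnCycle τ = ∃[ τ' ] (τ ↣ τ' × τ' ⇝ τ)

  successor-on-cycle : ∀ {τ τ'} → τ ↣ τ' → τ' ⇝ τ → OnCycle τ'
  successor-on-cycle e ε = _ , e , ε
  successor-on-cycle e (e' ◅ p) = _ , e' , (p ◅◅ (e ◅ ε))

  distinct-on-cycle : ∀ {τ σ} → τ ⇝ σ → τ ≢ σ → σ ⇝ τ → OnCycle τ
  distinct-on-cycle ε τ≢σ _ = contradiction refl τ≢σ
  distinct-on-cycle (e ◅ p) _ back = _ , e , (p ◅◅ back)

  inverse-of-cycle-node : ∀ {τ} → OnCycle τ → T (ΣUID Σᵤ (τ ⁻¹))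
  inverse-of-cycle-node (_ , e , back) = inverse-on-cycle e back

  reverse-edge : ∀ {τ τ'} → τ ↣ τ' → τ' ⇝ τ → (τ' ⁻¹) ↣ (τ ⁻¹)
  reverse-edge e@(_ , _ , τ'~τ , τ'≢τ , _) back =
    inverse-of-cycle-node (successor-on-cycle e back) , inverse-on-cycle e back ,
    sym τ'~τ , (λ eq → τ'≢τ (sym eq)) , reverse-ufd-on-cycle e back

  reverse-path : ∀ {τ σ} → τ ⇝ σ → σ ⇝ τ → (σ ⁻¹) ⇝ (τ ⁻¹)
  reverse-path ε _ = ε
  reverse-path (e ◅ p) back = reverse-path p (back ◅◅ (e ◅ ε)) ◅◅ (reverse-edge e (p ◅◅ back) ◅ ε)

  -- The target of an edge matters only through its left position, the source
  -- only through its right position.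
  edge-same-lhs : ∀ {τ σ σ'} → τ ↣ σ → T (ΣUID Σᵤ σ') → lhs σ' ≡ lhs σ → τ ↣ σ'
  edge-same-lhs (τ∈Σ , _ , σ~τ , σ≢τ , ufd) σ'∈Σ refl = τ∈Σ , σ'∈Σ , σ~τ , σ≢τ , ufd

  edge-same-rhs : ∀ {τ τ' σ} → τ ↣ σ → T (ΣUID Σᵤ τ') → rhs τ' ≡ rhs τ → τ' ↣ σ
  edge-same-rhs (_ , σ∈Σ , σ~τ , σ≢τ , ufd) τ'∈Σ refl = τ'∈Σ , σ∈Σ , σ~τ , σ≢τ , ufd

  last-edge : ∀ {τ τ' σ} → τ ↣ τ' → τ' ⇝ σ → ∃[ ρ ] (τ ⇝ ρ × ρ ↣ σ)
  last-edge e ε = _ , ε , e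
  last-edge e (e' ◅ p) with last-edge e' p
  ... | ρ , q , e'' = ρ , e ◅ q , e''

  scc-absorbs : ∀ {P} → IsSCC Σᵤ P → ∀ κ → T (ΣUID Σᵤ κ) →
                (∀ τ → T (P τ) → τ ⇝ κ) → (∀ τ → T (P τ) → κ ⇝ τ) → T (P κ)
  scc-absorbs {P} (P⊆Σ , _ , P-sc , P-max) κ κ∈Σ into out-of =
    P-max P+κ (λ τ Pτ → from T-∨ (inj₁ Pτ)) P+κ⊆Σ P+κ-sc κ
      (from (T-∨ {P κ}) (inj₂ (fromWitness refl)))
    where
    P+κ : Subset
    P+κ σ = P σ ∨ ⌊ σ ≟ᵤ κ ⌋
    member : ∀ σ → T (P+κ σ) → T (P σ) ⊎ σ ≡ κ
    member σ t with to T-∨ t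
    ... | inj₁ Pσ = inj₁ Pσ
    ... | inj₂ σ≡κ = inj₂ (toWitness σ≡κ)
    P+κ⊆Σ : P+κ ⊆ˢ ΣUID Σᵤ
    P+κ⊆Σ σ t with member σ t
    ... | inj₁ Pσ = P⊆Σ σ Pσ
    ... | inj₂ refl = κ∈Σ
    P+κ-sc : StronglyConnected Σᵤ P+κ
    P+κ-sc σ σ' t t' with member σ t | member σ' t'
    ... | inj₁ Pσ | inj₁ Pσ' = P-sc σ σ' Pσ Pσ'
    ... | inj₁ Pσ | inj₂ refl = into σ Pσ
    ... | inj₂ refl | inj₁ Pσ' = out-of σ' Pσ'
    ... | inj₂ refl | inj₂ refl = ε

  -- Transitivity of UIDs: τ and τ' compose to lhs τ ⊆ rhs τ' in every instance.
  composite-in-Σ : ∀ τ τ' → T (ΣUID Σᵤ τ) → T (ΣUID Σᵤ τ') → rhs τ ≡ lhs τ' →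
                   lhs τ ≢ rhs τ' → T (ΣUID Σᵤ (lhs τ ⊆ᵤ rhs τ'))
  composite-in-Σ τ τ' τ∈Σ τ'∈Σ rhs≡lhs lhs≢rhs =
    proj₁ fc (lhs τ ⊆ᵤ rhs τ') lhs≢rhs λ I I⊨Σ f a f∈I f[lhs]≡a →
      let (g , g∈I , g[rhs]≡a) = proj₁ I⊨Σ τ τ∈Σ f a f∈I f[lhs]≡a in
      proj₁ I⊨Σ τ' τ'∈Σ g a g∈I (subst (λ p → HasAt g p a) rhs≡lhs g[rhs]≡a)

  inverse-strongly-connected : ∀ {Q} → StronglyConnected Σᵤ Q →
                               StronglyConnected Σᵤ (inverseSet Q)
  inverse-strongly-connected Q-sc σ σ' Qσ⁻¹ Qσ'⁻¹ =
    reverse-path (Q-sc (σ' ⁻¹) (σ ⁻¹) Qσ'⁻¹ Qσ⁻¹) (Q-sc (σ ⁻¹) (σ' ⁻¹) Qσ⁻¹ Qσ'⁻¹)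

  -- In a strongly connected set every node other than σ₀ lies on a cycle through
  -- σ₀, so all inverses are in Σ_UID once the inverse of σ₀ is.
  inverses-in-Σ : ∀ {Q σ₀} → StronglyConnected Σᵤ Q → T (Q σ₀) → T (ΣUID Σᵤ (σ₀ ⁻¹)) →
                  inverseSet Q ⊆ˢ ΣUID Σᵤ
  inverses-in-Σ {σ₀ = σ₀} Q-sc Qσ₀ σ₀⁻¹∈Σ ρ Qρ⁻¹ with (ρ ⁻¹) ≟ᵤ σ₀
  ... | yes refl = σ₀⁻¹∈Σ
  ... | no ρ⁻¹≢σ₀ =
    inverse-of-cycle-node (distinct-on-cycle (Q-sc _ _ Qρ⁻¹ Qσ₀) ρ⁻¹≢σ₀ (Q-sc _ _ Qσ₀ Qρ⁻¹))

  -- Part 1: for τ, τ' ∈ P composing to κ = lhs τ ⊆ rhs τ', κ ∈ Σ_UID, and κ inherits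
  -- the incoming edges of τ and the outgoing edges of τ'; since τ' ⇝ τ is a non-empty
  -- path inside P, κ is strongly connected to P and hence belongs to P.
  scc-transitively-closed : ∀ P → IsSCC Σᵤ P → TransitivelyClosed P
  scc-transitively-closed P scc@(P⊆Σ , _ , P-sc , _) τ τ' Pτ Pτ' rhs≡lhs lhs≢rhs
    with P-sc τ' τ Pτ' Pτ
  ... | ε = contradiction (sym rhs≡lhs) (proj₁ wf τ (P⊆Σ τ Pτ))
  ... | τ'↣ρ₁ ◅ p with last-edge τ'↣ρ₁ p
  ...   | ρ , q , ρ↣τ = scc-absorbs scc κ κ∈Σ into out-of
    where
    κ : UID
    κ = lhs τ ⊆ᵤ rhs τ'
    κ∈Σ : T (ΣUID Σᵤ κ)
    κ∈Σ = composite-in-Σ τ τ' (P⊆Σ τ Pτ) (P⊆Σ τ' Pτ') rhs≡lhs lhs≢rhs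
    into : ∀ σ → T (P σ) → σ ⇝ κ
    into σ Pσ = P-sc σ τ' Pσ Pτ' ◅◅ (q ◅◅ (edge-same-lhs ρ↣τ κ∈Σ refl ◅ ε))
    out-of : ∀ σ → T (P σ) → κ ⇝ σ
    out-of σ Pσ = edge-same-rhs τ'↣ρ₁ κ∈Σ refl ◅ (p ◅◅ P-sc τ σ Pτ Pσ)

  -- If the inverse of some τ ∈ P were missing, τ would lie on no cycle; then
  -- P = {τ} without a self-loop, i.e. P would be trivial.
  nontrivial-scc-inverses : ∀ P → IsSCC Σᵤ P → NonTrivial Σᵤ P →
                            ∀ τ → T (P τ) → T (ΣUID Σᵤ (τ ⁻¹))
  nontrivial-scc-inverses P (_ , _ , P-sc , _) nontrivial τ Pτ =
    decidable-stable (T? _) λ τ⁻¹∉Σ →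
      nontrivial (τ , only-τ τ⁻¹∉Σ , Pτ , λ loop → τ⁻¹∉Σ (inverse-on-cycle loop ε))
    where
    only-τ : ¬ T (ΣUID Σᵤ (τ ⁻¹)) → ∀ σ → T (P σ) → σ ≡ τ
    only-τ τ⁻¹∉Σ σ Pσ = decidable-stable (σ ≟ᵤ τ) λ σ≢τ →
      τ⁻¹∉Σ (inverse-of-cycle-node
              (distinct-on-cycle (P-sc τ σ Pτ Pσ) (λ eq → σ≢τ (sym eq)) (P-sc σ τ Pσ Pτ)))

  -- Part 2: paths of P invert, so P⁻¹ is strongly connected; it is maximal because a
  -- larger strongly connected Q would give a strongly connected Q⁻¹ ⊋ P.
  nontrivial-scc-inverse-is-scc : ∀ P → IsSCC Σᵤ P → NonTrivial Σᵤ P → IsSCC Σᵤ (inverseSet P)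
  nontrivial-scc-inverse-is-scc P scc@(P⊆Σ , (τ₀ , Pτ₀) , P-sc , P-max) nontrivial =
    (λ σ → nontrivial-scc-inverses P scc nontrivial (σ ⁻¹)) ,
    (τ₀ ⁻¹ , Pτ₀) ,
    inverse-strongly-connected P-sc ,
    maximal
    where
    maximal : ∀ Q → inverseSet P ⊆ˢ Q → Q ⊆ˢ ΣUID Σᵤ → StronglyConnected Σᵤ Q →
              Q ⊆ˢ inverseSet P
    maximal Q P⁻¹⊆Q _ Q-sc σ Qσ =
      P-max (inverseSet Q) (λ τ → P⁻¹⊆Q (τ ⁻¹))
        (inverses-in-Σ Q-sc (P⁻¹⊆Q (τ₀ ⁻¹) Pτ₀) (P⊆Σ τ₀ Pτ₀))
        (inverse-strongly-connected Q-sc) (σ ⁻¹) Qσ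

mainTheorem13 : (n : ℕ) (arity : Fin n → ℕ) (Σᵤ : Schema.Constraints n arity) →
    Schema.WellFormed n arity Σᵤ → Schema.FinClosed n arity Σᵤ →
    (∀ P → Schema.IsSCC n arity Σᵤ P → Schema.TransitivelyClosed n arity P) ×
    (∀ P → Schema.IsSCC n arity Σᵤ P → Schema.NonTrivial n arity Σᵤ P →
      (∀ τ → T (P τ) → T (Schema.Constraints.ΣUID Σᵤ (Schema._⁻¹ n arity τ))) ×
      Schema.IsSCC n arity Σᵤ (Schema.inverseSet n arity P))
mainTheorem13 n arity Σᵤ wf fc =
  scc-transitively-closed ,
  λ P scc nontrivial → nontrivial-scc-inverses P scc nontrivial ,
                       nontrivial-scc-inverse-is-scc P scc nontrivial
  where open IDGraph Σᵤ wf fc
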